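{- Let $(X,\leq)$ be a partial order and let $U$ be a predicate on $X$. If $U$ is meet-closed and good, then $U$ is progressive.
   Context: For $x,y\in X$, $y>x$ means $y\geq x$ and $y\neq x$. A predicate $U$ on $X$ is progressive if for every $x\in X$: if $U(y)$ holds for all $y\in X$ with $y>x$, then $U(x)$ holds. For $x,y,z\in X$, $x=y\wedge z$ means that $x$ is the greatest lower bound of $y$ and $z$, i.e. for all $x'\in X$, $x'\leq x$ iff ($x'\leq y$ and $x'\leq z$). An element $x\in X$ is reducible if there are $y,z\in X$ with $x<y$, $x<z$ and $x=y\wedge z$. $U$ is good if for every $x\in X$, either $U(x)$ holds or $x$ is reducible. $U$ is meet-closed if whenever $x=y\wedge z$ in $X$, $U(y)$ and $U(z)$ together imply $U(x)$. (The setting is intuitionistic logic.) -}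

module Defs where

open import Level using (Level; _⊔_)
open import Data.Product using (Σ-syntax; _×_)
open import Data.Sum using (_⊎_)
open import Relation.Nullary using (¬_)
open import Relation.Unary using (Pred)
open import Relation.Binary.Bundles using (Poset)
open import Function.Bundles using (_⇔_)

module _ {c ℓ₁ ℓ₂ : Level} (P : Poset c ℓ₁ ℓ₂) where
  open Poset P

  _>ₚ_ : Carrier → Carrier → Set (ℓ₁ ⊔ ℓ₂)
  y >ₚ x = (x ≤ y) × ¬ (y ≈ x)

  IsMeet : Carrier → Carrier → Carrier → Set (c ⊔ ℓ₂)
  IsMeet x y z = ∀ x′ → (x′ ≤ x) ⇔ ((x′ ≤ y) × (x′ ≤ z))

  Reducible : Carrier → Set (c ⊔ ℓ₁ ⊔ ℓ₂)
  Reducible x = Σ[ y ∈ Carrier ] Σ[ z ∈ Carrier ]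
    (y >ₚ x) × (z >ₚ x) × IsMeet x y z

  module _ {u : Level} (U : Pred Carrier u) where

    Progressive : Set (c ⊔ ℓ₁ ⊔ ℓ₂ ⊔ u)
    Progressive = ∀ x → (∀ y → y >ₚ x → U y) → U x

    Good : Set (c ⊔ ℓ₁ ⊔ ℓ₂ ⊔ u)
    Good = ∀ x → U x ⊎ Reducible x

    MeetClosed : Set (c ⊔ ℓ₂ ⊔ u)
    MeetClosed = ∀ x y z → IsMeet x y z → U y → U z → U x

module Submission where

open import Defs
open import Level using (Level)
open import Relation.Unary using (Pred)
open import Relation.Binary.Bundles using (Poset)
open import Data.Sum using (inj₁; inj₂)
open import Data.Product using (_,_)

lemma4p1 : {c ℓ₁ ℓ₂ u : Level} (P : Poset c ℓ₁ ℓ₂) (U : Pred (Poset.Carrier P) u) →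
    MeetClosed P U → Good P U → Progressive P U
lemma4p1 P U meetClosed good x U-above with good x
... | inj₁ Ux = Ux
... | inj₂ (y , z , y>x , z>x , x≡y∧z) =
  meetClosed x y z x≡y∧z (U-above y y>x) (U-above z z>x)
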